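{- If a functor $F:\mathbf{Nom}\to\mathbf{Nom}$ has a sub-strength, then $F$ preserves epimorphisms (surjective equivariant maps) whose codomain is orbit-finite.
   Context: $\mathbf{Nom}$ is the category of nominal sets (sets with an action of the group of finite permutations of a fixed infinite set $\mathbb V$ of atoms in which every element $x$ has a finite support; $\mathrm{supp}(x)$ is the least support) and equivariant maps; orbit-finite means finitely many orbits. For nominal sets $X,Y$, $X<Y=\{(x,y)\in X\times Y\mid\mathrm{supp}(x)\subseteq\mathrm{supp}(y)\}$, with projection $\mathrm{outl}:X<Y\to X$. A sub-strength of $F$ is a family of equivariant maps $s_{X,Y}:FX<Y\to F(X<Y)$, indexed by nominal sets $X,Y$ and not necessarily natural, such that $F\mathrm{outl}\circ s_{X,Y}=\mathrm{outl}$. -}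

module Defs where

open import Data.Nat using (ℕ)
import Data.Nat
open import Data.List using (List; map)
open import Data.List.Membership.Propositional using (_∈_; _∉_)
open import Data.List.Membership.Propositional.Properties using (∈-map⁺; ∈-map⁻)
open import Data.List.Relation.Binary.Subset.Propositional using (_⊆_)
open import Data.List.Relation.Binary.Subset.DecPropositional Data.Nat._≟_ using (_⊆?_)
open import Relation.Nullary.Decidable using (recompute)
open import Data.List.Relation.Unary.Any using (Any)
open import Data.Product using (Σ; ∃; _×_; _,_; proj₁; proj₂)
open import Relation.Binary.PropositionalEquality
  using (_≡_; refl; sym; trans; cong; subst)

Atom : Set
Atom = ℕ

record Perm : Set where
  field
    to      : Atom → Atom
    from    : Atom → Atom
    from-to : ∀ a → from (to a) ≡ a
    to-from : ∀ a → to (from a) ≡ a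
    dom     : List Atom
    fixes   : ∀ a → a ∉ dom → to a ≡ a
open Perm public

idₚ : Perm
idₚ = record { to = λ a → a ; from = λ a → a ; from-to = λ _ → refl
             ; to-from = λ _ → refl ; dom = Data.List.[] ; fixes = λ _ _ → refl }

_∘ₚ_ : Perm → Perm → Perm
π ∘ₚ σ = record
  { to = λ a → to π (to σ a)
  ; from = λ a → from σ (from π a)
  ; from-to = λ a → trans (cong (from σ) (from-to π (to σ a))) (from-to σ a)
  ; to-from = λ a → trans (cong (to π) (to-from σ (from π a))) (to-from π a)
  ; dom = dom π Data.List.++ dom σ
  ; fixes = λ a a∉ → trans (cong (to π) (fixes σ a (λ m → a∉ (∈-++⁺ʳ (dom π) m))))
                           (fixes π a (λ m → a∉ (∈-++⁺ˡ m)))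
  }
  where open import Data.List.Membership.Propositional.Properties
          using (∈-++⁺ˡ; ∈-++⁺ʳ)

-- The action must respect extensional equality of permutations (since
-- Perm records carry proof data).

record NomSet : Set₁ where
  field
    Carrier : Set
    _·_     : Perm → Carrier → Carrier
    act-id  : ∀ x → idₚ · x ≡ x
    act-∘   : ∀ π σ x → (π ∘ₚ σ) · x ≡ π · (σ · x)
    act-ext : ∀ π σ → (∀ a → to π a ≡ to σ a) → ∀ x → π · x ≡ σ · x

  Supports : List Atom → Carrier → Set
  Supports S x = ∀ π → (∀ a → a ∈ S → to π a ≡ a) → π · x ≡ x

  field
    supp          : Carrier → List Atom
    supp-supports : ∀ x → Supports (supp x) x
    supp-least    : ∀ x S → Supports S x → supp x ⊆ S
open NomSet public

record _⇒_ (X Y : NomSet) : Set where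
  field
    fun   : Carrier X → Carrier Y
    equiv : ∀ π x → fun (_·_ X π x) ≡ _·_ Y π (fun x)
open _⇒_ public

idᴺ : ∀ {X} → X ⇒ X
idᴺ = record { fun = λ x → x ; equiv = λ _ _ → refl }

_∘ᴺ_ : ∀ {X Y Z} → Y ⇒ Z → X ⇒ Y → X ⇒ Z
g ∘ᴺ f = record { fun = λ x → fun g (fun f x)
                ; equiv = λ π x → trans (cong (fun g) (equiv f π x)) (equiv g π (fun f x)) }

Surjective : ∀ {X Y} → X ⇒ Y → Set
Surjective {X} {Y} f = ∀ (y : Carrier Y) → ∃ λ (x : Carrier X) → fun f x ≡ y

OrbitFinite : NomSet → Set
OrbitFinite X =
  ∃ λ (reps : List (Carrier X)) →
    ∀ (x : Carrier X) → Any (λ r → ∃ λ π → _·_ X π r ≡ x) reps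

-- Endofunctors on Nom (functor laws up to pointwise equality, since
-- morphisms are equal iff their underlying functions are).

record Functor : Set₁ where
  field
    F₀     : NomSet → NomSet
    F₁     : ∀ {X Y} → X ⇒ Y → F₀ X ⇒ F₀ Y
    F-resp : ∀ {X Y} (f g : X ⇒ Y) → (∀ x → fun f x ≡ fun g x) →
             ∀ z → fun (F₁ f) z ≡ fun (F₁ g) z
    F-id   : ∀ {X} z → fun (F₁ (idᴺ {X})) z ≡ z
    F-∘    : ∀ {X Y Z} (g : Y ⇒ Z) (f : X ⇒ Y) z →
             fun (F₁ (g ∘ᴺ f)) z ≡ fun (F₁ g) (fun (F₁ f) z)
open Functor public

invₚ : Perm → Perm
invₚ π = record { to = from π ; from = to π ; from-to = to-from π
                ; to-from = from-to π ; dom = dom π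
                ; fixes = λ a a∉ → trans (cong (from π) (sym (fixes π a a∉))) (from-to π a) }

module _ (X : NomSet) where
  private
    _⊙_ = _·_ X

  inv-cancel : ∀ π x → invₚ π ⊙ (π ⊙ x) ≡ x
  inv-cancel π x = trans (sym (act-∘ X (invₚ π) π x))
                         (trans (act-ext X _ idₚ (from-to π) x) (act-id X x))

  cancel-inv : ∀ π x → π ⊙ (invₚ π ⊙ x) ≡ x
  cancel-inv π x = trans (sym (act-∘ X π (invₚ π) x))
                         (trans (act-ext X _ idₚ (to-from π) x) (act-id X x))

  supports-act : ∀ π S x → Supports X S x → Supports X (map (to π) S) (π ⊙ x)
  supports-act π S x sup σ fix =
    trans (sym (cancel-inv π (σ ⊙ (π ⊙ x))))
          (cong (π ⊙_) (trans (sym (trans (act-∘ X (invₚ π) (σ ∘ₚ π) x)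
                                          (cong (invₚ π ⊙_) (act-∘ X σ π x))))
                              (sup _ λ a a∈ → trans (cong (from π) (fix (to π a) (∈-map⁺ (to π) a∈)))
                                                    (from-to π a))))

  supp-act⊆ : ∀ π x → supp X (π ⊙ x) ⊆ map (to π) (supp X x)
  supp-act⊆ π x = supp-least X (π ⊙ x) _ (supports-act π _ x (supp-supports X x))

  supp-act⊇ : ∀ π x {a} → a ∈ supp X x → to π a ∈ supp X (π ⊙ x)
  supp-act⊇ π x {a} a∈ with ∈-map⁻ (from π)
      (subst (λ z → a ∈ supp X z) (sym (inv-cancel π x)) a∈ |> supp-act⊆ (invₚ π) (π ⊙ x))
    where _|>_ : ∀ {A B : Set} → A → (A → B) → B
          v |> f = f v
  ... | b , b∈ , refl = subst (_∈ supp X (π ⊙ x)) (sym (to-from π b)) b∈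

record LtPair (X Y : NomSet) : Set where
  constructor lt
  field
    fst : Carrier X
    snd : Carrier Y
    .sub : supp X fst ⊆ supp Y snd
open LtPair public

-- the (irrelevant) inclusion proof can be recomputed, since ⊆ on
-- lists of atoms is decidable
sub! : ∀ {X Y} (z : LtPair X Y) → supp X (fst z) ⊆ supp Y (snd z)
sub! {X} {Y} (lt x y p) = recompute (supp X x ⊆? supp Y y) p

LtPair-≡ : ∀ {X Y} {x x' : Carrier X} {y y' : Carrier Y}
           .{p : supp X x ⊆ supp Y y} .{p' : supp X x' ⊆ supp Y y'} →
           x ≡ x' → y ≡ y' → _≡_ {A = LtPair X Y} (record { fst = x ; snd = y ; sub = p })
                              (record { fst = x' ; snd = y' ; sub = p' })
LtPair-≡ refl refl = refl

_<ᴺ_ : NomSet → NomSet → NomSet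
X <ᴺ Y = record
  { Carrier = LtPair X Y
  ; _·_ = act
  ; act-id = λ z → LtPair-≡ (act-id X (fst z)) (act-id Y (snd z))
  ; act-∘ = λ π σ z → LtPair-≡ (act-∘ X π σ (fst z)) (act-∘ Y π σ (snd z))
  ; act-ext = λ π σ e z → LtPair-≡ (act-ext X π σ e (fst z)) (act-ext Y π σ e (snd z))
  ; supp = λ z → supp Y (snd z)
  ; supp-supports = λ z π fix →
      LtPair-≡ (supp-supports X (fst z) π (λ a a∈ → fix a (sub! z a∈)))
               (supp-supports Y (snd z) π fix)
  ; supp-least = λ z S sup → supp-least Y (snd z) S (λ π fix → cong snd (sup π fix))
  }
  where
  act : Perm → LtPair X Y → LtPair X Y
  act π z = record
    { fst = _·_ X π (fst z)
    ; snd = _·_ Y π (snd z)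
    ; sub = λ c∈ → lemma π z c∈
    }
    where
    lemma : ∀ π (z : LtPair X Y) → supp X (_·_ X π (fst z)) ⊆ supp Y (_·_ Y π (snd z))
    lemma π z c∈ with ∈-map⁻ (to π) (supp-act⊆ X π (fst z) c∈)
    ... | a , a∈ , refl = supp-act⊇ Y π (snd z) (sub! z a∈)

outl : ∀ {X Y} → (X <ᴺ Y) ⇒ X
outl = record { fun = fst ; equiv = λ _ _ → refl }

-- Sub-strength: equivariant maps s_{X,Y} : FX < Y → F(X < Y), not
-- necessarily natural, with  F outl ∘ s_{X,Y} = outl.

record SubStrength (F : Functor) : Set₁ where
  field
    s      : ∀ X Y → (F₀ F X <ᴺ Y) ⇒ F₀ F (X <ᴺ Y)
    s-outl : ∀ X Y z → fun (F₁ F (outl {X} {Y})) (fun (s X Y) z) ≡ fun (outl {F₀ F X} {Y}) z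

module Submission where

-- Let e : X → Y be surjective and Y orbit-finite.  Choosing a preimage
-- of each of the finitely many orbit representatives gives a bound K
-- such that every y has a preimage supported by at most K atoms.  Let
-- C = Names (2K) be the nominal set of duplicate-free lists of at least
-- 2K atoms.  We build an equivariant section h : Y < C → X with
-- e ∘ h = outl: for (y , c) with c of length m, let σ be the "frame"
-- permutation sending the canonical atoms 0, …, m-1 onto c, pick a small
-- preimage of σ⁻¹ y and move its support into {0, …, m-1} by a
-- relocation fixing supp (σ⁻¹ y) (there are enough spare atoms because
-- m ≥ 2K), and transport the result back with σ.
-- Only atoms in {0, …, m-1} matter, which makes h equivariant.  Finally,
-- for z ∈ F Y choose c ∈ C with supp z ⊆ supp c; then F h (s (z , c))
-- is a preimage of z, since F e ∘ F h = F outl and F outl ∘ s = outl.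

open import Defs
open import Data.Nat using (ℕ; suc; _+_; _≤_; z≤n; s≤s; _≟_; _≤?_)
open import Data.Nat.Properties
  using (≤-trans; ≤-reflexive; <-irrefl; suc-injective; +-cancelˡ-≤; +-mono-≤; m≤n⇒m⊓n≡m)
open import Data.List using (List; []; _∷_; map; _++_; length; upTo; take; filter; deduplicate)
open import Data.List.Properties
  using ( ∷-injective; map-id-local; map-∘; map-cong; length-map; length-upTo; length-take
        ; length-++; length-filter; length-deduplicate; filter-notAll)
open import Data.List.Extrema.Nat using (max; xs≤max)
open import Data.List.Membership.Propositional using (_∈_; _∉_; find; lose)
open import Data.List.Membership.Propositional.Properties
  using (∈-map⁺; ∈-map⁻; ∈-++⁺ˡ; ∈-++⁺ʳ; ∈-filter⁺; ∈-filter⁻; ∈-deduplicate⁺; ∈-deduplicate⁻)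
open import Data.List.Membership.DecPropositional _≟_ using (_∈?_; _∉?_)
open import Data.List.Relation.Unary.Any using (here; there)
import Data.List.Relation.Unary.All as All
open import Data.List.Relation.Unary.AllPairs using (_∷_)
open import Data.List.Relation.Unary.Unique.Propositional using (Unique)
open import Data.List.Relation.Unary.Unique.Propositional.Properties
  using (map⁺; filter⁺; take⁺; upTo⁺)
open import Data.List.Relation.Unary.Unique.DecPropositional _≟_ using (unique?)
open import Data.List.Relation.Unary.Unique.DecPropositional.Properties _≟_ using (deduplicate-!)
open import Data.List.Relation.Binary.Subset.Propositional using (_⊆_)
open import Data.List.Relation.Binary.Sublist.Propositional using (lookup)
open import Data.List.Relation.Binary.Sublist.Propositional.Properties using (take-⊆)
open import Data.Product using (∃; _,_; proj₁; proj₂)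
open import Data.Empty using (⊥-elim)
open import Relation.Nullary using (yes; no; ¬?)
open import Relation.Nullary.Decidable using (recompute)
open import Relation.Binary.PropositionalEquality
  using (_≡_; _≢_; refl; sym; trans; cong; cong₂; subst; module ≡-Reasoning)

unique-length : ∀ {xs ys : List Atom} → Unique xs → xs ⊆ ys → length xs ≤ length ys
unique-length {[]} _ _ = z≤n
unique-length {x ∷ xs} {ys} (x∉xs ∷ xs!) xs⊆ys =
  ≤-trans (s≤s (unique-length xs! xs⊆rest))
          (filter-notAll (λ y → ¬? (y ≟ x)) ys (lose (xs⊆ys (here refl)) (λ x≢x → x≢x refl)))
  where
  xs⊆rest : xs ⊆ filter (λ y → ¬? (y ≟ x)) ys
  xs⊆rest a∈ = ∈-filter⁺ (λ y → ¬? (y ≟ x)) (xs⊆ys (there a∈))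
                          (λ a≡x → All.lookup x∉xs a∈ (sym a≡x))

fresh : List Atom → Atom
fresh xs = suc (max 0 xs)

fresh-∉ : ∀ xs → fresh xs ∉ xs
fresh-∉ xs fresh∈ = <-irrefl refl (All.lookup (xs≤max 0 xs) fresh∈)

map-agree : ∀ {f g : Atom → Atom} xs {a} → map f xs ≡ map g xs → a ∈ xs → f a ≡ g a
map-agree (x ∷ xs) eq (here refl) = proj₁ (∷-injective eq)
map-agree (x ∷ xs) eq (there a∈)  = map-agree xs (proj₂ (∷-injective eq)) a∈

swap : Atom → Atom → Atom → Atom
swap a b x with x ≟ a
... | yes _ = b
... | no _ with x ≟ b
...   | yes _ = a
...   | no _  = x

swap-left : ∀ a b → swap a b a ≡ b
swap-left a b with a ≟ a
... | yes _ = refl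
... | no a≢a = ⊥-elim (a≢a refl)

swap-right : ∀ a b → swap a b b ≡ a
swap-right a b with b ≟ a
... | yes b≡a = b≡a
... | no _ with b ≟ b
...   | yes _ = refl
...   | no b≢b = ⊥-elim (b≢b refl)

swap-other : ∀ a b x → x ≢ a → x ≢ b → swap a b x ≡ x
swap-other a b x x≢a x≢b with x ≟ a
... | yes x≡a = ⊥-elim (x≢a x≡a)
... | no _ with x ≟ b
...   | yes x≡b = ⊥-elim (x≢b x≡b)
...   | no _    = refl

swap-involutive : ∀ a b x → swap a b (swap a b x) ≡ x
swap-involutive a b x with x ≟ a
... | yes refl = swap-right a b
... | no x≢a with x ≟ b
...   | yes refl = swap-left a b
...   | no x≢b   = swap-other a b x x≢a x≢b

transposition : Atom → Atom → Perm
transposition a b = record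
  { to = swap a b ; from = swap a b
  ; from-to = swap-involutive a b ; to-from = swap-involutive a b
  ; dom = a ∷ b ∷ []
  ; fixes = λ x x∉ → swap-other a b x (λ x≡a → x∉ (here x≡a)) (λ x≡b → x∉ (there (here x≡b)))
  }

to-injective : ∀ π {x y} → to π x ≡ to π y → x ≡ y
to-injective π {x} {y} eq = trans (sym (from-to π x)) (trans (cong (from π) eq) (from-to π y))

listPerm : List Atom → List Atom → Perm
listPerm (a ∷ u) (c ∷ v) = transposition c (to (listPerm u v) a) ∘ₚ listPerm u v
listPerm _ _ = idₚ

listPerm-fixes : ∀ u v x → x ∉ u → x ∉ v → to (listPerm u v) x ≡ x
listPerm-fixes [] v x _ _ = refl
listPerm-fixes (a ∷ u) [] x _ _ = refl
listPerm-fixes (a ∷ u) (c ∷ v) x x∉au x∉cv =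
  trans (cong (swap c (to σ a)) σx≡x)
        (swap-other c (to σ a) x (λ x≡c → x∉cv (here x≡c))
                                 (λ x≡σa → x∉au (here (to-injective σ (trans σx≡x x≡σa)))))
  where
  σ = listPerm u v
  σx≡x = listPerm-fixes u v x (λ x∈u → x∉au (there x∈u)) (λ x∈v → x∉cv (there x∈v))

listPerm-map : ∀ u v → Unique u → Unique v → length u ≡ length v → map (to (listPerm u v)) u ≡ v
listPerm-map [] [] _ _ _ = refl
listPerm-map (a ∷ u) (c ∷ v) (a∉u ∷ u!) (c∉v ∷ v!) len =
  cong₂ _∷_ (swap-right c (to σ a))
    (begin
      map (λ x → swap c (to σ a) (to σ x)) u ≡⟨ map-∘ u ⟩
      map (swap c (to σ a)) (map (to σ) u)  ≡⟨ cong (map (swap c (to σ a))) σu≡v ⟩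
      map (swap c (to σ a)) v               ≡⟨ map-id-local (All.tabulate swap-fixes-v) ⟩
      v                                     ∎)
  where
  open ≡-Reasoning
  σ = listPerm u v
  σu≡v = listPerm-map u v u! v! (suc-injective len)
  -- neither c nor σ a (the image of a ∉ u) occurs in v = σ u
  swap-fixes-v : ∀ {y} → y ∈ v → swap c (to σ a) y ≡ y
  swap-fixes-v {y} y∈v = swap-other c (to σ a) y (λ y≡c → All.lookup c∉v y∈v (sym y≡c)) y≢σa
    where
    y≢σa : y ≢ to σ a
    y≢σa y≡σa with ∈-map⁻ (to σ) (subst (y ∈_) (sym σu≡v) y∈v)
    ... | a' , a'∈u , refl = All.lookup a∉u a'∈u (to-injective σ (sym y≡σa))

module Relocation (A b : List Atom) where
  outside : List Atom
  outside = deduplicate _≟_ (filter (_∉? b) A)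

  spare : List Atom
  spare = filter (_∉? A) b

  targets : List Atom
  targets = take (length outside) spare

  relocation : Perm
  relocation = listPerm outside targets

  relocation-fixes : ∀ a → a ∈ A → a ∈ b → to relocation a ≡ a
  relocation-fixes a a∈A a∈b = listPerm-fixes outside targets a
    (λ a∈out → proj₂ (∈-filter⁻ (_∉? b) {xs = A} (∈-deduplicate⁻ _≟_ _ a∈out)) a∈b)
    (λ a∈tgt → proj₂ (∈-filter⁻ (_∉? A) {xs = b} (lookup (take-⊆ (length outside) spare) a∈tgt)) a∈A)

  -- if b has no duplicates and is twice as long as A, then b has at
  -- least length A spare atoms, as b ⊆ A ++ spare
  spare-large : Unique b → length A + length A ≤ length b → length A ≤ length spare
  spare-large b! bound = +-cancelˡ-≤ (length A) (length A) (length spare)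
    (≤-trans bound (≤-trans (unique-length b! b⊆A++spare) (≤-reflexive (length-++ A))))
    where
    b⊆A++spare : b ⊆ A ++ spare
    b⊆A++spare {a} a∈b with a ∈? A
    ... | yes a∈A = ∈-++⁺ˡ a∈A
    ... | no a∉A  = ∈-++⁺ʳ A (∈-filter⁺ (_∉? A) a∈b a∉A)

  relocation-into : Unique b → length A + length A ≤ length b → ∀ a → a ∈ A → to relocation a ∈ b
  relocation-into b! bound a a∈A with a ∈? b
  ... | yes a∈b = subst (_∈ b) (sym (relocation-fixes a a∈A a∈b)) a∈b
  ... | no a∉b  = proj₁ (∈-filter⁻ (_∉? A) {xs = b} (lookup (take-⊆ (length outside) spare) ρa∈targets))
    where
    outside-short : length outside ≤ length spare
    outside-short = ≤-trans (length-deduplicate _≟_ (filter (_∉? b) A))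
                      (≤-trans (length-filter (_∉? b) A) (spare-large b! bound))
    maps-onto : map (to relocation) outside ≡ targets
    maps-onto = listPerm-map outside targets (deduplicate-! _)
      (take⁺ (length outside) (filter⁺ (_∉? A) b!))
      (sym (trans (length-take (length outside) spare) (m≤n⇒m⊓n≡m outside-short)))
    ρa∈targets : to relocation a ∈ targets
    ρa∈targets = subst (to relocation a ∈_) maps-onto
      (∈-map⁺ (to relocation) (∈-deduplicate⁺ _≟_ (∈-filter⁺ (_∉? b) a∈A a∉b)))

open Relocation using (relocation; relocation-fixes; relocation-into)

record NameList (N : ℕ) : Set where
  constructor names
  field
    atoms     : List Atom
    .distinct : Unique atoms
    .long     : N ≤ length atoms
open NameList

names-≡ : ∀ {N l l'} .{d : Unique l} .{g : N ≤ length l} .{d' : Unique l'} .{g' : N ≤ length l'} →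
          l ≡ l' → names l d g ≡ names l' d' g'
names-≡ refl = refl

distinct! : ∀ {N} (c : NameList N) → Unique (atoms c)
distinct! (names l d _) = recompute (unique? l) d

long! : ∀ {N} (c : NameList N) → N ≤ length (atoms c)
long! {N} (names l _ g) = recompute (N ≤? length l) g

renameNames : ∀ {N} → Perm → NameList N → NameList N
renameNames {N} π (names l d g) =
  names (map (to π) l) (map⁺ (to-injective π) d) (subst (N ≤_) (sym (length-map (to π) l)) g)

-- Any finite set S supports c only if atoms c ⊆ S: otherwise swapping
-- some a ∈ atoms c outside S with a fresh atom would fix c.
atoms-least : ∀ {N} (c : NameList N) S →
              (∀ π → (∀ a → a ∈ S → to π a ≡ a) → renameNames π c ≡ c) → atoms c ⊆ S
atoms-least c S supports {a} a∈c with a ∈? S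
... | yes a∈S = a∈S
... | no a∉S  = ⊥-elim (fresh-∉ (S ++ atoms c) (∈-++⁺ʳ S f∈c))
  where
  f = fresh (S ++ atoms c)
  swap-fixes-S : ∀ x → x ∈ S → swap a f x ≡ x
  swap-fixes-S x x∈S = swap-other a f x (λ x≡a → a∉S (subst (_∈ S) x≡a x∈S))
                                        (λ x≡f → fresh-∉ (S ++ atoms c) (∈-++⁺ˡ (subst (_∈ S) x≡f x∈S)))
  f∈c : f ∈ atoms c
  f∈c = subst (f ∈_) (cong atoms (supports (transposition a f) swap-fixes-S))
          (subst (_∈ map (swap a f) (atoms c)) (swap-left a f) (∈-map⁺ (swap a f) a∈c))

Names : ℕ → NomSet
Names N = record
  { Carrier       = NameList N
  ; _·_           = renameNames
  ; act-id        = λ c → names-≡ (map-id-local (All.tabulate (λ _ → refl)))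
  ; act-∘         = λ π σ c → names-≡ (map-∘ (atoms c))
  ; act-ext       = λ π σ eq c → names-≡ (map-cong eq (atoms c))
  ; supp          = atoms
  ; supp-supports = λ c π fix → names-≡ (map-id-local (All.tabulate (λ {a} a∈ → fix a a∈)))
  ; supp-least    = atoms-least
  }

names-around : ∀ N (S : List Atom) → ∃ λ (c : NameList N) → S ⊆ atoms c
names-around N S = names l (deduplicate-! (S ++ upTo N)) l-long , λ a∈S → ∈-deduplicate⁺ _≟_ (∈-++⁺ˡ a∈S)
  where
  l = deduplicate _≟_ (S ++ upTo N)
  l-long : N ≤ length l
  l-long = subst (_≤ length l) (length-upTo N)
           (unique-length (upTo⁺ N) (λ a∈ → ∈-deduplicate⁺ _≟_ (∈-++⁺ʳ S a∈)))

fixes-supported : ∀ Z {x S} τ → supp Z x ⊆ S → (∀ a → a ∈ S → to τ a ≡ a) → _·_ Z τ x ≡ x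
fixes-supported Z {x} τ supp⊆S τ-fixes = supp-supports Z x τ (λ a a∈ → τ-fixes a (supp⊆S a∈))

supp-equivariant : ∀ {X Y} (f : X ⇒ Y) x → supp Y (fun f x) ⊆ supp X x
supp-equivariant {X} {Y} f x = supp-least Y (fun f x) (supp X x)
  (λ π fix → trans (sym (equiv f π x)) (cong (fun f) (supp-supports X x π fix)))

supp-pullback : ∀ Z σ {b l} y → map (to σ) b ≡ l → supp Z y ⊆ l → supp Z (_·_ Z (invₚ σ) y) ⊆ b
supp-pullback Z σ {b} y σb≡l y⊆l a∈ with ∈-map⁻ (from σ) (supp-act⊆ Z (invₚ σ) y a∈)
... | a' , a'∈y , refl with ∈-map⁻ (to σ) (subst (a' ∈_) (sym σb≡l) (y⊆l a'∈y))
...   | a'' , a''∈b , refl = subst (_∈ b) (sym (from-to σ a'')) a''∈b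

act-conjugate : ∀ Z σ' π σ z →
                _·_ Z (invₚ σ' ∘ₚ (π ∘ₚ σ)) z ≡ _·_ Z (invₚ σ') (_·_ Z π (_·_ Z σ z))
act-conjugate Z σ' π σ z = trans (act-∘ Z (invₚ σ') (π ∘ₚ σ) z) (cong (_·_ Z (invₚ σ')) (act-∘ Z π σ z))

record SmallPreimage {X Y : NomSet} (e : X ⇒ Y) (K : ℕ) (y : Carrier Y) : Set where
  field
    point       : Carrier X
    maps-to     : fun e point ≡ y
    cover       : List Atom
    cover-small : length cover ≤ K
    cover-supp  : supp X point ⊆ cover
open SmallPreimage

-- Along a surjection onto an orbit-finite set, preimages with uniformly
-- bounded supports exist: translate the chosen preimages of the orbit
-- representatives.
small-preimages : ∀ {X Y} (e : X ⇒ Y) → Surjective e → OrbitFinite Y →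
                  ∃ λ K → ∀ y → SmallPreimage e K y
small-preimages {X} {Y} e surj (reps , orbits) = K , small
  where
  pre : Carrier Y → Carrier X
  pre r = proj₁ (surj r)
  K = max 0 (map (λ r → length (supp X (pre r))) reps)
  small : ∀ y → SmallPreimage e K y
  small y with find (orbits y)
  ... | r , r∈reps , π , πr≡y = record
    { point       = _·_ X π (pre r)
    ; maps-to     = trans (equiv e π (pre r)) (trans (cong (_·_ Y π) (proj₂ (surj r))) πr≡y)
    ; cover       = map (to π) (supp X (pre r))
    ; cover-small = subst (_≤ K) (sym (length-map (to π) (supp X (pre r))))
                      (All.lookup (xs≤max 0 _) (∈-map⁺ (λ r → length (supp X (pre r))) r∈reps))
    ; cover-supp  = supp-act⊆ X π (pre r)
    }

module Section {X Y : NomSet} (e : X ⇒ Y) {K : ℕ} (small : ∀ y → SmallPreimage e K y) where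
  private
    _·X_ = _·_ X
    _·Y_ = _·_ Y

  normalise : List Atom → Carrier Y → Carrier X
  normalise b y = relocation (cover (small y)) b ·X point (small y)

  -- It is a preimage as long as b contains supp y: the relocation then
  -- fixes supp y ⊆ supp (point (small y)) ⊆ cover (small y).
  normalise-maps-to : ∀ b y → supp Y y ⊆ b → fun e (normalise b y) ≡ y
  normalise-maps-to b y y⊆b = begin
      fun e (ρ ·X x) ≡⟨ equiv e ρ x ⟩
      ρ ·Y fun e x   ≡⟨ cong (ρ ·Y_) (maps-to (small y)) ⟩
      ρ ·Y y         ≡⟨ supp-supports Y y ρ (λ a a∈y → relocation-fixes A b a (y⊆A a∈y) (y⊆b a∈y)) ⟩
      y              ∎
    where
    open ≡-Reasoning
    A = cover (small y)
    x = point (small y)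
    ρ = relocation A b
    y⊆A : supp Y y ⊆ A
    y⊆A a∈y = cover-supp (small y)
      (supp-equivariant e x (subst (λ w → _ ∈ supp Y w) (sym (maps-to (small y))) a∈y))

  normalise-supp : ∀ b y → Unique b → K + K ≤ length b → supp X (normalise b y) ⊆ b
  normalise-supp b y b! bound a∈ with ∈-map⁻ (to ρ) (supp-act⊆ X ρ (point (small y)) a∈)
    where ρ = relocation (cover (small y)) b
  ... | a' , a'∈x , refl =
    relocation-into (cover (small y)) b b!
      (≤-trans (+-mono-≤ (cover-small (small y)) (cover-small (small y))) bound)
      a' (cover-supp (small y) a'∈x)

  -- name lists must be long enough to host a relocated small preimage
  N : ℕ
  N = K + K

  base : NameList N → List Atom
  base c = upTo (length (atoms c))

  frame : NameList N → Perm
  frame c = listPerm (base c) (atoms c)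

  frame-map : ∀ c → map (to (frame c)) (base c) ≡ atoms c
  frame-map c = listPerm-map (base c) (atoms c) (upTo⁺ _) (distinct! c) (length-upTo _)

  base-long : ∀ c → K + K ≤ length (base c)
  base-long c = subst (N ≤_) (sym (length-upTo _)) (long! c)

  base-rename : ∀ π c → base (renameNames π c) ≡ base c
  base-rename π c = cong upTo (length-map (to π) (atoms c))

  frame-rename : ∀ π c a → a ∈ base c → to (frame (renameNames π c)) a ≡ to π (to (frame c) a)
  frame-rename π c a a∈ = map-agree (base c) frames-agree a∈
    where
    open ≡-Reasoning
    σ  = frame c
    σ' = frame (renameNames π c)
    frames-agree : map (to σ') (base c) ≡ map (λ x → to π (to σ x)) (base c)
    frames-agree = begin
      map (to σ') (base c)                 ≡⟨ cong (map (to σ')) (sym (base-rename π c)) ⟩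
      map (to σ') (base (renameNames π c)) ≡⟨ frame-map (renameNames π c) ⟩
      map (to π) (atoms c)                 ≡⟨ cong (map (to π)) (sym (frame-map c)) ⟩
      map (to π) (map (to σ) (base c))     ≡⟨ sym (map-∘ (base c)) ⟩
      map (λ x → to π (to σ x)) (base c)   ∎

  section-fun : LtPair Y (Names N) → Carrier X
  section-fun p = frame (snd p) ·X normalise (base (snd p)) (invₚ (frame (snd p)) ·Y fst p)

  normalised-supp : ∀ (p : LtPair Y (Names N)) → supp Y (invₚ (frame (snd p)) ·Y fst p) ⊆ base (snd p)
  normalised-supp p = supp-pullback Y (frame (snd p)) (fst p) (frame-map (snd p)) (sub! p)

  section-splits : ∀ p → fun e (section-fun p) ≡ fst p
  section-splits p = begin
      fun e (σ ·X normalise (base c) y₀) ≡⟨ equiv e σ _ ⟩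
      σ ·Y fun e (normalise (base c) y₀) ≡⟨ cong (σ ·Y_) (normalise-maps-to (base c) y₀ (normalised-supp p)) ⟩
      σ ·Y y₀                            ≡⟨ cancel-inv Y σ (fst p) ⟩
      fst p                              ∎
    where
    open ≡-Reasoning
    c = snd p
    σ = frame c
    y₀ = invₚ σ ·Y fst p

  -- Equivariance: with σ, σ' the frames of c and π · c, the permutation
  -- τ = σ'⁻¹ ∘ π ∘ σ fixes the canonical atoms, hence fixes both σ⁻¹ · y
  -- and its normal preimage.
  section-equivariant : ∀ π p → section-fun (_·_ (Y <ᴺ Names N) π p) ≡ π ·X section-fun p
  section-equivariant π p = begin
      σ' ·X normalise (base (renameNames π c)) (invₚ σ' ·Y (π ·Y y)) ≡⟨ cong₂ (λ b w → σ' ·X normalise b w) (base-rename π c) y-moved ⟩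
      σ' ·X x₀                                                      ≡⟨ cong (σ' ·X_) (sym (fixes-supported X τ x₀-supp τ-fixes)) ⟩
      σ' ·X (τ ·X x₀)                                               ≡⟨ cong (σ' ·X_) (act-conjugate X σ' π σ x₀) ⟩
      σ' ·X (invₚ σ' ·X (π ·X (σ ·X x₀)))                           ≡⟨ cancel-inv X σ' _ ⟩
      π ·X (σ ·X x₀)                                                ∎
    where
    open ≡-Reasoning
    y = fst p
    c = snd p
    σ = frame c
    σ' = frame (renameNames π c)
    τ = invₚ σ' ∘ₚ (π ∘ₚ σ)
    y₀ = invₚ σ ·Y y
    x₀ = normalise (base c) y₀
    τ-fixes : ∀ a → a ∈ base c → to τ a ≡ a
    τ-fixes a a∈ = trans (cong (from σ') (sym (frame-rename π c a a∈))) (from-to σ' a)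
    x₀-supp : supp X x₀ ⊆ base c
    x₀-supp = normalise-supp (base c) y₀ (upTo⁺ _) (base-long c)
    y-moved : invₚ σ' ·Y (π ·Y y) ≡ y₀
    y-moved = begin
      invₚ σ' ·Y (π ·Y y)          ≡⟨ cong (λ w → invₚ σ' ·Y (π ·Y w)) (sym (cancel-inv Y σ y)) ⟩
      invₚ σ' ·Y (π ·Y (σ ·Y y₀))  ≡⟨ sym (act-conjugate Y σ' π σ y₀) ⟩
      τ ·Y y₀                      ≡⟨ fixes-supported Y τ (normalised-supp p) τ-fixes ⟩
      y₀                           ∎

  section : (Y <ᴺ Names N) ⇒ X
  section = record { fun = section-fun ; equiv = section-equivariant }

-- If e has an equivariant section h over Y < C (that is, e ∘ h = outl)
-- and every finite set of atoms is contained in the support of some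
-- c ∈ C, then F e is surjective: F h (s (z , c)) is a preimage of z,
-- because F e ∘ F h = F (e ∘ h) = F outl and F outl ∘ s = outl.
surjective-from-section : (F : Functor) → SubStrength F →
  ∀ {X Y C} (e : X ⇒ Y) (h : (Y <ᴺ C) ⇒ X) → (∀ p → fun e (fun h p) ≡ fst p) →
  (∀ (S : List Atom) → ∃ λ c → S ⊆ supp C c) → Surjective (F₁ F e)
surjective-from-section F S {Y = Y} {C} e h splits around z =
  fun (F₁ F h) w , (begin
    fun (F₁ F e) (fun (F₁ F h) w) ≡⟨ sym (F-∘ F e h w) ⟩
    fun (F₁ F (e ∘ᴺ h)) w         ≡⟨ F-resp F (e ∘ᴺ h) outl splits w ⟩
    fun (F₁ F outl) w             ≡⟨ SubStrength.s-outl S Y C pair ⟩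
    z                             ∎)
  where
  open ≡-Reasoning
  c = proj₁ (around (supp (F₀ F Y) z))
  pair : LtPair (F₀ F Y) C
  pair = lt z c (proj₂ (around (supp (F₀ F Y) z)))
  w = fun (SubStrength.s S Y C) pair

proposition3 : (F : Functor) → SubStrength F →
    ∀ {X Y : NomSet} (e : X ⇒ Y) → Surjective e → OrbitFinite Y →
    Surjective (F₁ F e)
proposition3 F S e surj orbit-finite =
  surjective-from-section F S e section section-splits (names-around N)
  where
  open Section e (proj₂ (small-preimages e surj orbit-finite))
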